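{- Let $N$ be an integer with $N\equiv 1\pmod 6$. Then there exist integers $A,B$ with $N=A^2+3B^2$ if and only if there exist integers $J,K$ with $4N=(6J+1)^2+3(6K+1)^2$. -}

{-# OPTIONS --safe #-}
-- Write norm x y = x² + 3y².  The identities 4·norm A B = norm (A + 3B) (A − B)
-- = norm (A − 3B) (A + B) give two representations of 4N.  When N ≡ 1 (mod 6),
-- comparing N with (A ± 3B)² and (A ± B)² shows that A ± 3B and A ± B are odd,
-- that 3 ∤ A ± 3B, and that 3 cannot divide both A − B and A + B; so one
-- representation has both entries prime to 6, i.e. ≡ ±1 (mod 6), and signs are
-- irrelevant under squaring.  Conversely, if 4N = norm X Y with X ≡ Y (mod 4) then
-- N = norm ((X + 3Y)/4) ((X − Y)/4); for X = 6J + 1 and Y = 6K + 1 either X or −X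
-- is congruent to Y modulo 4.
module Submission where

open import Data.Integer using (ℤ; +_; _+_; _-_; _*_; -_)
open import Data.Integer.Divisibility using (_∣_)
open import Data.Integer.Divisibility.Signed
  renaming (_∣_ to _∣ˢ_)
  using (divides; ∣ᵤ⇒∣; ∣⇒∣ᵤ; ∣-refl; ∣-trans; ∣m∣n⇒∣m+n; ∣m∣n⇒∣m-n; ∣m⇒∣m*n; _∣?_)
open import Data.Integer.DivMod using (_/_; _%_; a≡a%n+[a/n]*n; n%d<d)
open import Data.Integer.Properties using (*-cancelˡ-≡; +-identityˡ; +-comm)
open import Data.Integer.Tactic.RingSolver using (solve; solve-∀)
open import Data.List using (_∷_; [])
open import Data.Nat using (suc; _<_; s≤s)
open import Data.Nat.Divisibility using (∣1⇒≡1)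
open import Data.Product using (∃; ∃₂; _×_; _,_)
open import Data.Sum using (_⊎_; inj₁; inj₂)
open import Relation.Binary.PropositionalEquality using (_≡_; refl; sym; trans; cong; cong₂; subst)
open import Relation.Nullary using (¬_; Dec; yes; no; contradiction)
open Relation.Binary.PropositionalEquality.≡-Reasoning

norm : ℤ → ℤ → ℤ
norm x y = x * x + + 3 * (y * y)
-- Inlined so that the ring solver sees the polynomial rather than an opaque call.
{-# INLINE norm #-}

IsNorm : ℤ → Set
IsNorm n = ∃₂ λ A B → n ≡ norm A B

IsNormOf1Mod6 : ℤ → Set
IsNormOf1Mod6 n = ∃₂ λ J K → n ≡ norm (+ 6 * J + + 1) (+ 6 * K + + 1)

CoprimeTo6 : ℤ → Set
CoprimeTo6 x = (¬ + 2 ∣ˢ x) × (¬ + 3 ∣ˢ x)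

2∣6 : + 2 ∣ˢ + 6
2∣6 = divides (+ 3) refl

3∣6 : + 3 ∣ˢ + 6
3∣6 = divides (+ 2) refl

∤1 : ∀ {d} → ¬ + suc (suc d) ∣ˢ + 1
∤1 d∣1 = contradiction (∣1⇒≡1 (∣⇒∣ᵤ d∣1)) λ ()

∣n∣n-1⇒∣1 : ∀ {d n} → d ∣ˢ n → d ∣ˢ n - + 1 → d ∣ˢ + 1
∣n∣n-1⇒∣1 {d} {n} d∣n d∣n-1 = subst (d ∣ˢ_) n-[n-1]≡1 (∣m∣n⇒∣m-n d∣n d∣n-1)
  where
  n-[n-1]≡1 : n - (n - + 1) ≡ + 1
  n-[n-1]≡1 = solve (n ∷ [])

6∣n-1⇒coprimeTo6 : ∀ {n} → + 6 ∣ˢ n - + 1 → CoprimeTo6 n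
6∣n-1⇒coprimeTo6 6∣n-1 =
  (λ 2∣n → ∤1 (∣n∣n-1⇒∣1 2∣n (∣-trans 2∣6 6∣n-1))) ,
  (λ 3∣n → ∤1 (∣n∣n-1⇒∣1 3∣n (∣-trans 3∣6 6∣n-1)))

∤x*x+y*z⇒∤x : ∀ {d} n x y z → n ≡ x * x + y * z → d ∣ˢ y → ¬ d ∣ˢ n → ¬ d ∣ˢ x
∤x*x+y*z⇒∤x n x y z refl d∣y d∤n d∣x = d∤n (∣m∣n⇒∣m+n (∣m⇒∣m*n x d∣x) (∣m⇒∣m*n z d∣y))

coprimeTo6-x*x+6z⇒coprimeTo6-x : ∀ n x z → n ≡ x * x + + 6 * z → CoprimeTo6 n → CoprimeTo6 x
coprimeTo6-x*x+6z⇒coprimeTo6-x n x z n≡ (2∤n , 3∤n) =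
  ∤x*x+y*z⇒∤x n x (+ 6) z n≡ 2∣6 2∤n , ∤x*x+y*z⇒∤x n x (+ 6) z n≡ 3∣6 3∤n

coprimeTo6⇒square-of-1-mod-6 : ∀ x → CoprimeTo6 x → ∃ λ J → x * x ≡ (+ 6 * J + + 1) * (+ 6 * J + + 1)
coprimeTo6⇒square-of-1-mod-6 x = by-residue (x % + 6) (x / + 6) (n%d<d x (+ 6)) (a≡a%n+[a/n]*n x (+ 6))
  where
  by-residue : ∀ {x} r q → r < 6 → x ≡ + r + q * + 6 → CoprimeTo6 x →
               ∃ λ J → x * x ≡ (+ 6 * J + + 1) * (+ 6 * J + + 1)
  by-residue 0 q _ x≡ (2∤x , _) = contradiction (divides (q * + 3) (trans x≡ (solve (q ∷ [])))) 2∤x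
  by-residue 1 q _ x≡ _ = q , trans (cong (λ y → y * y) x≡) (solve (q ∷ []))
  by-residue 2 q _ x≡ (2∤x , _) = contradiction (divides (+ 1 + q * + 3) (trans x≡ (solve (q ∷ [])))) 2∤x
  by-residue 3 q _ x≡ (_ , 3∤x) = contradiction (divides (+ 1 + q * + 2) (trans x≡ (solve (q ∷ [])))) 3∤x
  by-residue 4 q _ x≡ (2∤x , _) = contradiction (divides (+ 2 + q * + 3) (trans x≡ (solve (q ∷ [])))) 2∤x
  -- 6q + 5 = −(6(−q − 1) + 1)
  by-residue 5 q _ x≡ _ = - q - + 1 , trans (cong (λ y → y * y) x≡) (solve (q ∷ []))
  by-residue (suc (suc (suc (suc (suc (suc _)))))) _ (s≤s (s≤s (s≤s (s≤s (s≤s (s≤s ())))))) _ _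

norm-coprimeTo6⇒isNormOf1Mod6 : ∀ {m} x y → m ≡ norm x y → CoprimeTo6 x → CoprimeTo6 y →
                                IsNormOf1Mod6 m
norm-coprimeTo6⇒isNormOf1Mod6 x y refl x-coprime y-coprime
  with J , x²≡ ← coprimeTo6⇒square-of-1-mod-6 x x-coprime
     | K , y²≡ ← coprimeTo6⇒square-of-1-mod-6 y y-coprime
  = J , K , cong₂ (λ u v → u + + 3 * v) x²≡ y²≡

4*norm≡norm[x+3y,x-y] : ∀ x y → + 4 * norm x y ≡ norm (x + + 3 * y) (x - y)
4*norm≡norm[x+3y,x-y] = solve-∀

4*norm≡norm[x-3y,x+y] : ∀ x y → + 4 * norm x y ≡ norm (x - + 3 * y) (x + y)
4*norm≡norm[x-3y,x+y] = solve-∀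

isNorm⇒4*isNormOf1Mod6 : ∀ {N} → CoprimeTo6 N → IsNorm N → IsNormOf1Mod6 (+ 4 * N)
isNorm⇒4*isNormOf1Mod6 N-coprime@(2∤N , 3∤N) (A , B , refl) = choose-representation (+ 3 ∣? A - B)
  where
  A+3B-coprime : CoprimeTo6 (A + + 3 * B)
  A+3B-coprime = coprimeTo6-x*x+6z⇒coprimeTo6-x
    (norm A B) (A + + 3 * B) (- (B * (A + B))) (solve (A ∷ B ∷ [])) N-coprime

  A-3B-coprime : CoprimeTo6 (A - + 3 * B)
  A-3B-coprime = coprimeTo6-x*x+6z⇒coprimeTo6-x
    (norm A B) (A - + 3 * B) (B * (A - B)) (solve (A ∷ B ∷ [])) N-coprime

  2∤A-B : ¬ + 2 ∣ˢ A - B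
  2∤A-B = ∤x*x+y*z⇒∤x (norm A B) (A - B) (+ 2) (B * (A + B)) (solve (A ∷ B ∷ [])) ∣-refl 2∤N

  2∤A+B : ¬ + 2 ∣ˢ A + B
  2∤A+B = ∤x*x+y*z⇒∤x (norm A B) (A + B) (+ 2) (B * (B - A)) (solve (A ∷ B ∷ [])) ∣-refl 2∤N

  3∣A-B⇒3∤A+B : + 3 ∣ˢ A - B → ¬ + 3 ∣ˢ A + B
  3∣A-B⇒3∤A+B 3∣A-B 3∣A+B =
    ∤x*x+y*z⇒∤x (norm A B) (A - B) (A + B) (+ 2 * B) (solve (A ∷ B ∷ [])) 3∣A+B 3∤N 3∣A-B

  choose-representation : Dec (+ 3 ∣ˢ A - B) → IsNormOf1Mod6 (+ 4 * norm A B)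
  choose-representation (no 3∤A-B) =
    norm-coprimeTo6⇒isNormOf1Mod6 (A + + 3 * B) (A - B) (4*norm≡norm[x+3y,x-y] A B)
      A+3B-coprime (2∤A-B , 3∤A-B)
  choose-representation (yes 3∣A-B) =
    norm-coprimeTo6⇒isNormOf1Mod6 (A - + 3 * B) (A + B) (4*norm≡norm[x-3y,x+y] A B)
      A-3B-coprime (2∤A+B , 3∣A-B⇒3∤A+B 3∣A-B)

even-or-odd : ∀ n → ∃ λ t → n ≡ t * + 2 ⊎ n ≡ t * + 2 + + 1
even-or-odd n with n % + 2 | n%d<d n (+ 2) | a≡a%n+[a/n]*n n (+ 2)
... | 0 | _ | n≡ = n / + 2 , inj₁ (trans n≡ (+-identityˡ (n / + 2 * + 2)))
... | 1 | _ | n≡ = n / + 2 , inj₂ (trans n≡ (+-comm (+ 1) (n / + 2 * + 2)))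
... | suc (suc _) | s≤s (s≤s ()) | _

norm[-x,y]≡norm[x,y] : ∀ x y → norm (- x) y ≡ norm x y
norm[-x,y]≡norm[x,y] = solve-∀

4*norm[y+m,m]≡norm[y+4m,y] : ∀ y m → + 4 * norm (y + m) m ≡ norm (y + m * + 4) y
4*norm[y+m,m]≡norm[y+4m,y] = solve-∀

4∣x-y⇒4*n≡norm⇒isNorm : ∀ {n} x y → + 4 ∣ˢ x - y → + 4 * n ≡ norm x y → IsNorm n
4∣x-y⇒4*n≡norm⇒isNorm {n} x y (divides m x-y≡m*4) 4n≡ =
  y + m , m , *-cancelˡ-≡ (+ 4) n (norm (y + m) m) (begin
    + 4 * n              ≡⟨ 4n≡ ⟩
    norm x y             ≡⟨ cong (λ u → norm u y) x≡y+4m ⟩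
    norm (y + m * + 4) y ≡⟨ sym (4*norm[y+m,m]≡norm[y+4m,y] y m) ⟩
    + 4 * norm (y + m) m ∎)
  where
  x≡y+4m : x ≡ y + m * + 4
  x≡y+4m = begin
    x           ≡⟨ solve (x ∷ y ∷ []) ⟩
    y + (x - y) ≡⟨ cong (λ u → y + u) x-y≡m*4 ⟩
    y + m * + 4 ∎

-- 6J + 1 ≡ 6K + 1 (mod 4) when J − K is even; otherwise −(6J + 1) ≡ 6K + 1 (mod 4).
4*isNormOf1Mod6⇒isNorm : ∀ {n} → IsNormOf1Mod6 (+ 4 * n) → IsNorm n
4*isNormOf1Mod6⇒isNorm (J , K , 4n≡) with even-or-odd (J - K)
... | t , inj₁ J-K≡2t =
  4∣x-y⇒4*n≡norm⇒isNorm (+ 6 * J + + 1) (+ 6 * K + + 1) (divides (+ 3 * t) (begin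
    (+ 6 * J + + 1) - (+ 6 * K + + 1) ≡⟨ solve (J ∷ K ∷ []) ⟩
    + 6 * (J - K)                     ≡⟨ cong (λ u → + 6 * u) J-K≡2t ⟩
    + 6 * (t * + 2)                   ≡⟨ solve (t ∷ []) ⟩
    + 3 * t * + 4                     ∎)) 4n≡
... | t , inj₂ J-K≡2t+1 =
  4∣x-y⇒4*n≡norm⇒isNorm (- (+ 6 * J + + 1)) (+ 6 * K + + 1) (divides (- (+ 3 * t + + 3 * K + + 2)) (begin
    - (+ 6 * J + + 1) - (+ 6 * K + + 1)          ≡⟨ solve (J ∷ K ∷ []) ⟩
    - (+ 6 * (J - K) + + 12 * K + + 2)           ≡⟨ cong (λ u → - (+ 6 * u + + 12 * K + + 2)) J-K≡2t+1 ⟩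
    - (+ 6 * (t * + 2 + + 1) + + 12 * K + + 2)   ≡⟨ solve (t ∷ K ∷ []) ⟩
    - (+ 3 * t + + 3 * K + + 2) * + 4            ∎))
    (trans 4n≡ (sym (norm[-x,y]≡norm[x,y] (+ 6 * J + + 1) (+ 6 * K + + 1))))

lemma4p10 : (N : ℤ) → (+ 6) ∣ (N - + 1) →
    ((∃₂ λ A B → N ≡ A * A + + 3 * (B * B)) → (∃₂ λ J K → + 4 * N ≡ (+ 6 * J + + 1) * (+ 6 * J + + 1) + + 3 * ((+ 6 * K + + 1) * (+ 6 * K + + 1))))
    × ((∃₂ λ J K → + 4 * N ≡ (+ 6 * J + + 1) * (+ 6 * J + + 1) + + 3 * ((+ 6 * K + + 1) * (+ 6 * K + + 1))) → (∃₂ λ A B → N ≡ A * A + + 3 * (B * B)))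
lemma4p10 N 6∣N-1 = isNorm⇒4*isNormOf1Mod6 (6∣n-1⇒coprimeTo6 (∣ᵤ⇒∣ 6∣N-1)) , 4*isNormOf1Mod6⇒isNorm
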